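{- If $G$ and $H$ are non-trivial connected graphs with $\gamma_{r2}(H)=3$, then \[2\gamma(G)\le \gamma_{r2}(G\circ H)\le \min\{\,2|A|+3|B| \;:\; (A,B) \text{ is a dominating couple of } G\,\}.\]
   Context: All graphs are finite and simple; non-trivial means at least two vertices. A $2$-rainbow dominating function of a graph $X$ is a map $f\colon V(X)\to 2^{\{1,2\}}$ such that for every vertex $v$ with $f(v)=\emptyset$ we have $\bigcup_{u\in N(v)} f(u)=\{1,2\}$; its weight is $\sum_v |f(v)|$, and $\gamma_{r2}(X)$ is the minimum weight of such a function. The lexicographic product $G\circ H$ has vertex set $V(G)\times V(H)$, with $(g_1,h_1)$ adjacent to $(g_2,h_2)$ iff $g_1g_2\in E(G)$, or $g_1=g_2$ and $h_1h_2\in E(H)$. $\gamma(G)$ is the domination number of $G$. An ordered pair $(A,B)$ of disjoint subsets $A,B\subseteq V(G)$ is a dominating couple of $G$ if for every vertex $x\in V(G)\setminus B$ there is a vertex $w\in A\cup B$ with $x\in N_G(w)$. -}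

module Defs where

open import Data.Nat using (ℕ; zero; suc; _+_; _*_; _≤_)
open import Data.Fin using (Fin; zero; suc; remQuot)
open import Data.Bool using (Bool; true; false)
open import Data.Product using (Σ; ∃; _×_; _,_; proj₁; proj₂)
open import Data.Sum using (_⊎_)
open import Relation.Nullary using (¬_; Dec)
open import Relation.Binary.PropositionalEquality using (_≡_)
open import Relation.Binary.Construct.Closure.ReflexiveTransitive using (Star)

record Graph : Set₁ where
  field
    n     : ℕ
    Adj   : Fin n → Fin n → Set
    adj?  : (u v : Fin n) → Dec (Adj u v)
    sym   : ∀ {u v} → Adj u v → Adj v u
    irr   : ∀ {u} → ¬ Adj u u
open Graph public

V : Graph → Set
V G = Fin (n G)

sumFin : (k : ℕ) → (Fin k → ℕ) → ℕ
sumFin zero    f = 0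
sumFin (suc k) f = f zero + sumFin k (λ i → f (suc i))

b2n : Bool → ℕ
b2n true  = 1
b2n false = 0

card : {k : ℕ} → (Fin k → Bool) → ℕ
card {k} S = sumFin k (λ i → b2n (S i))

NonTrivial : Graph → Set
NonTrivial G = 2 ≤ n G

Connected : Graph → Set
Connected G = (u v : V G) → Star (Adj G) u v

-- Lexicographic product G ∘ H on Fin (n G * n H); vertex k corresponds to the
-- pair remQuot k = (g , h).
lexAdj : (G H : Graph) → Fin (n G * n H) → Fin (n G * n H) → Set
lexAdj G H k l with remQuot {n G} (n H) k | remQuot {n G} (n H) l
... | (g₁ , h₁) | (g₂ , h₂) = Adj G g₁ g₂ ⊎ (g₁ ≡ g₂ × Adj H h₁ h₂)

IsDominating : (G : Graph) → (V G → Bool) → Set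
IsDominating G D = (v : V G) → D v ≡ true ⊎ Σ (V G) (λ u → D u ≡ true × Adj G u v)

IsDomNum : Graph → ℕ → Set
IsDomNum G k = Σ (V G → Bool) (λ D → IsDominating G D × card D ≡ k)
             × ((D : V G → Bool) → IsDominating G D → k ≤ card D)

-- 2-rainbow dominating functions, for a vertex set Fin m with adjacency R.
-- f v = (a , b) encodes f(v) ⊆ {1,2} with 1 ∈ f(v) iff a = true, 2 ∈ f(v) iff b = true.
IsR2DF : (m : ℕ) → (Fin m → Fin m → Set) → (Fin m → Bool × Bool) → Set
IsR2DF m R f = (v : Fin m) → f v ≡ (false , false) →
  Σ (Fin m) (λ u → R v u × proj₁ (f u) ≡ true) ×
  Σ (Fin m) (λ u → R v u × proj₂ (f u) ≡ true)

r2weight : (m : ℕ) → (Fin m → Bool × Bool) → ℕ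
r2weight m f = sumFin m (λ v → b2n (proj₁ (f v)) + b2n (proj₂ (f v)))

IsR2Num' : (m : ℕ) → (Fin m → Fin m → Set) → ℕ → Set
IsR2Num' m R k = Σ (Fin m → Bool × Bool) (λ f → IsR2DF m R f × r2weight m f ≡ k)
               × ((f : Fin m → Bool × Bool) → IsR2DF m R f → k ≤ r2weight m f)

IsR2Num : Graph → ℕ → Set
IsR2Num G k = IsR2Num' (n G) (Adj G) k

IsR2NumLex : Graph → Graph → ℕ → Set
IsR2NumLex G H k = IsR2Num' (n G * n H) (lexAdj G H) k

IsDomCouple : (G : Graph) → (V G → Bool) → (V G → Bool) → Set
IsDomCouple G A B =
  ((x : V G) → ¬ (A x ≡ true × B x ≡ true)) ×
  ((x : V G) → B x ≡ false →
     Σ (V G) (λ w → (A w ≡ true ⊎ B w ≡ true) × Adj G w x))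

-- Lower bound: collapse a 2-rainbow dominating function f of G ∘ H fibrewise, giving the
-- fibre over g both colours if its weight is at least 2 and otherwise exactly the colours
-- occurring in it. The total size of the collapse is at most the weight of f, and for each
-- colour the vertices carrying it dominate G: a fibre of weight at most 1 in a non-trivial H
-- has an unlabelled vertex, whose neighbour of that colour cannot lie in the same fibre.
--
-- Upper bound: for a dominating couple (A , B) put {1,2} on one vertex of every fibre over A
-- and a copy of a minimum 2-rainbow dominating function of H on every fibre over B. Such a
-- function may be taken to use both colours: if it labels every vertex, then H has at most
-- as many vertices as its weight, and colouring one vertex 1 and all others 2 is as good.

module Submission where

open import Defs hiding (sym)
open import Data.Nat using (ℕ; zero; suc; _+_; _*_; _≤_; _<_; _≤ᵇ_; z≤n; s≤s)
open import Data.Nat.Properties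
  using (≤-refl; ≤-trans; ≤-reflexive; <-≤-trans; <⇒≱; ≰⇒>; +-mono-≤; +-identityʳ; m≤m+n;
         +-assoc; *-identityʳ; *-zeroʳ; *-distribˡ-+; ≤ᵇ⇒≤; ≤⇒≤ᵇ; +-commutativeSemigroup;
         module ≤-Reasoning)
open import Algebra.Properties.CommutativeSemigroup +-commutativeSemigroup using (interchange)
open import Data.Bool using (Bool; true; false; _∨_; T)
open import Data.Bool.Properties using (∨-zeroʳ; ∨-conicalˡ) renaming (_≟_ to _≟ᵇ_)
open import Data.Fin using (Fin; zero; suc; remQuot; combine; _↑ˡ_; _↑ʳ_)
open import Data.Fin.Properties using (remQuot-combine; combine-remQuot; any?)
open import Data.Product using (Σ; _×_; _,_; proj₁; proj₂; uncurry)
open import Data.Product.Properties using (≡-dec)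
open import Data.Sum using (_⊎_; inj₁; inj₂)
open import Data.Unit using (tt)
open import Function using (id)
open import Relation.Nullary using (¬_; yes; no; contradiction)
open import Relation.Binary.PropositionalEquality
  using (_≡_; _≢_; refl; sym; trans; cong; cong₂; subst)

sumFin-cong : ∀ k {φ ψ : Fin k → ℕ} → (∀ i → φ i ≡ ψ i) → sumFin k φ ≡ sumFin k ψ
sumFin-cong zero    φ≗ψ = refl
sumFin-cong (suc k) φ≗ψ = cong₂ _+_ (φ≗ψ zero) (sumFin-cong k (λ i → φ≗ψ (suc i)))

sumFin-mono : ∀ k {φ ψ : Fin k → ℕ} → (∀ i → φ i ≤ ψ i) → sumFin k φ ≤ sumFin k ψ
sumFin-mono zero    φ≤ψ = z≤n
sumFin-mono (suc k) φ≤ψ = +-mono-≤ (φ≤ψ zero) (sumFin-mono k (λ i → φ≤ψ (suc i)))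

sumFin-const : ∀ k c → sumFin k (λ _ → c) ≡ k * c
sumFin-const zero    c = refl
sumFin-const (suc k) c = cong (c +_) (sumFin-const k c)

sumFin-+ : ∀ k (φ ψ : Fin k → ℕ) → sumFin k (λ i → φ i + ψ i) ≡ sumFin k φ + sumFin k ψ
sumFin-+ zero    φ ψ = refl
sumFin-+ (suc k) φ ψ =
  trans (cong (φ zero + ψ zero +_) (sumFin-+ k (λ i → φ (suc i)) (λ i → ψ (suc i))))
        (interchange (φ zero) (ψ zero) _ _)

sumFin-*ˡ : ∀ k c (φ : Fin k → ℕ) → sumFin k (λ i → c * φ i) ≡ c * sumFin k φ
sumFin-*ˡ zero    c φ = sym (*-zeroʳ c)
sumFin-*ˡ (suc k) c φ =
  trans (cong (c * φ zero +_) (sumFin-*ˡ k c (λ i → φ (suc i))))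
        (sym (*-distribˡ-+ c (φ zero) _))

sumFin-↑ : ∀ a b (φ : Fin (a + b) → ℕ) →
  sumFin (a + b) φ ≡ sumFin a (λ i → φ (i ↑ˡ b)) + sumFin b (λ j → φ (a ↑ʳ j))
sumFin-↑ zero    b φ = refl
sumFin-↑ (suc a) b φ =
  trans (cong (φ zero +_) (sumFin-↑ a b (λ i → φ (suc i))))
        (sym (+-assoc (φ zero) _ _))

sumFin-combine : ∀ m k (φ : Fin (m * k) → ℕ) →
  sumFin (m * k) φ ≡ sumFin m (λ i → sumFin k (λ j → φ (combine i j)))
sumFin-combine zero    k φ = refl
sumFin-combine (suc m) k φ =
  trans (sumFin-↑ k (m * k) φ)
        (cong (sumFin k (λ j → φ (j ↑ˡ (m * k))) +_) (sumFin-combine m k (λ v → φ (k ↑ʳ v))))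

anyFin : ∀ k → (Fin k → Bool) → Bool
anyFin zero    p = false
anyFin (suc k) p = p zero ∨ anyFin k (λ i → p (suc i))

anyFin-intro : ∀ k (p : Fin k → Bool) i → p i ≡ true → anyFin k p ≡ true
anyFin-intro (suc k) p zero    pi≡true = cong (_∨ anyFin k (λ i → p (suc i))) pi≡true
anyFin-intro (suc k) p (suc i) pi≡true =
  trans (cong (p zero ∨_) (anyFin-intro k (λ j → p (suc j)) i pi≡true)) (∨-zeroʳ (p zero))

anyFin≤sumFin : ∀ k (p : Fin k → Bool) → b2n (anyFin k p) ≤ sumFin k (λ i → b2n (p i))
anyFin≤sumFin zero    p = z≤n
anyFin≤sumFin (suc k) p with p zero
... | true  = s≤s z≤n
... | false = anyFin≤sumFin k (λ i → p (suc i))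

∅ : Bool × Bool
∅ = (false , false)

size : Bool × Bool → ℕ
size x = b2n (proj₁ x) + b2n (proj₂ x)

Colour : Set
Colour = Bool × Bool → Bool

Uses : ∀ {m} → Colour → (Fin m → Bool × Bool) → Set
Uses {m} c f = Σ (Fin m) (λ i → c (f i) ≡ true)

Sees : ∀ {m} → (Fin m → Fin m → Set) → (Fin m → Bool × Bool) → Colour → Fin m → Set
Sees {m} R f c v = Σ (Fin m) (λ u → R v u × c (f u) ≡ true)

size-nonempty : ∀ x → x ≢ ∅ → 1 ≤ size x
size-nonempty (true  , _)     x≢∅ = s≤s z≤n
size-nonempty (false , true)  x≢∅ = s≤s z≤n
size-nonempty (false , false) x≢∅ = contradiction refl x≢∅

r2weight-nonempty : ∀ k (f : Fin k → Bool × Bool) → (∀ i → f i ≢ ∅) → k ≤ r2weight k f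
r2weight-nonempty k f f≢∅ =
  subst (_≤ r2weight k f) (trans (sumFin-const k 1) (*-identityʳ k))
        (sumFin-mono k (λ i → size-nonempty (f i) (f≢∅ i)))

r2weight<⇒empty : ∀ k (f : Fin k → Bool × Bool) → r2weight k f < k → Σ (Fin k) (λ i → f i ≡ ∅)
r2weight<⇒empty k f light with any? (λ i → ≡-dec _≟ᵇ_ _≟ᵇ_ (f i) ∅)
... | yes empty = empty
... | no  none  = contradiction (r2weight-nonempty k f (λ i fi≡∅ → none (i , fi≡∅))) (<⇒≱ light)

peak : ∀ {k} → Fin k → Bool × Bool
peak zero    = (true , true)
peak (suc _) = ∅

peak-top : ∀ {k} → Fin k → Σ (Fin k) (λ i → peak i ≡ (true , true))
peak-top zero    = zero , refl
peak-top (suc _) = zero , refl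

r2weight-peak : ∀ k → r2weight k peak ≤ 2
r2weight-peak zero    = z≤n
r2weight-peak (suc k) = ≤-reflexive (cong (2 +_) (trans (sumFin-const k 0) (*-zeroʳ k)))

r2df-bichromatic : ∀ {m} (R : Fin m → Fin m → Set) (f : Fin m → Bool × Bool) →
  2 ≤ m → IsR2DF m R f →
  Σ (Fin m → Bool × Bool) (λ f′ →
    IsR2DF m R f′ × r2weight m f′ ≤ r2weight m f × Uses proj₁ f′ × Uses proj₂ f′)
r2df-bichromatic {m} R f 2≤m isR2 with any? (λ i → ≡-dec _≟ᵇ_ _≟ᵇ_ (f i) ∅)
... | yes (v , fv≡∅) =
  let ((u₁ , _ , c₁) , (u₂ , _ , c₂)) = isR2 v fv≡∅
  in f , isR2 , ≤-refl , (u₁ , c₁) , (u₂ , c₂)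
... | no none =
  split , (λ v split≡∅ → contradiction split≡∅ (split-nonempty v)) , split-light , split-bichromatic 2≤m
  where
  split : ∀ {k} → Fin k → Bool × Bool
  split zero    = (true , false)
  split (suc _) = (false , true)

  split-nonempty : ∀ {k} (i : Fin k) → split i ≢ ∅
  split-nonempty zero    ()
  split-nonempty (suc i) ()

  split-light : r2weight m split ≤ r2weight m f
  split-light = begin
    r2weight m split        ≤⟨ sumFin-mono m split≤1 ⟩
    sumFin m (λ _ → 1)      ≡⟨ trans (sumFin-const m 1) (*-identityʳ m) ⟩
    m                       ≤⟨ r2weight-nonempty m f (λ i fi≡∅ → none (i , fi≡∅)) ⟩
    r2weight m f            ∎
    where
    open ≤-Reasoning
    split≤1 : ∀ {k} (i : Fin k) → size (split i) ≤ 1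
    split≤1 zero    = ≤-refl
    split≤1 (suc i) = ≤-refl

  split-bichromatic : ∀ {k} → 2 ≤ k → Uses proj₁ (split {k}) × Uses proj₂ (split {k})
  split-bichromatic (s≤s (s≤s _)) = (zero , refl) , (suc zero , refl)

collapseᶜ : ∀ {k} → Colour → (Fin k → Bool × Bool) → Bool
collapseᶜ {k} c φ = (2 ≤ᵇ r2weight k φ) ∨ anyFin k (λ i → c (φ i))

collapse : ∀ {k} → (Fin k → Bool × Bool) → Bool × Bool
collapse φ = (collapseᶜ proj₁ φ , collapseᶜ proj₂ φ)

collapseᶜ-intro : ∀ {k} c (φ : Fin k → Bool × Bool) i → c (φ i) ≡ true → collapseᶜ c φ ≡ true
collapseᶜ-intro {k} c φ i cφi≡true =
  trans (cong ((2 ≤ᵇ r2weight k φ) ∨_) (anyFin-intro k (λ j → c (φ j)) i cφi≡true))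
        (∨-zeroʳ _)

collapseᶜ-false⇒light : ∀ {k} c (φ : Fin k → Bool × Bool) →
  collapseᶜ c φ ≡ false → ¬ 2 ≤ r2weight k φ
collapseᶜ-false⇒light {k} c φ eq heavy =
  subst T (∨-conicalˡ (2 ≤ᵇ r2weight k φ) _ eq) (≤⇒≤ᵇ heavy)

size-collapse : ∀ k (φ : Fin k → Bool × Bool) → size (collapse φ) ≤ r2weight k φ
size-collapse k φ with 2 ≤ᵇ r2weight k φ in heavy
... | true  = ≤ᵇ⇒≤ 2 (r2weight k φ) (subst T (sym heavy) tt)
... | false = begin
  b2n (anyFin k (λ i → proj₁ (φ i))) + b2n (anyFin k (λ i → proj₂ (φ i)))
    ≤⟨ +-mono-≤ (anyFin≤sumFin k (λ i → proj₁ (φ i))) (anyFin≤sumFin k (λ i → proj₂ (φ i))) ⟩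
  sumFin k (λ i → b2n (proj₁ (φ i))) + sumFin k (λ i → b2n (proj₂ (φ i)))
    ≡⟨ sym (sumFin-+ k _ _) ⟩
  r2weight k φ
    ∎
  where open ≤-Reasoning

module Lexicographic (G H : Graph) where

  LexAdj : V G → V H → V G → V H → Set
  LexAdj g h g′ h′ = Adj G g g′ ⊎ (g ≡ g′ × Adj H h h′)

  lexAdj-combine : ∀ g h g′ h′ → lexAdj G H (combine g h) (combine g′ h′) ≡ LexAdj g h g′ h′
  lexAdj-combine g h g′ h′ =
    cong₂ (λ (p q : V G × V H) → LexAdj (proj₁ p) (proj₂ p) (proj₁ q) (proj₂ q))
          (remQuot-combine g h) (remQuot-combine g′ h′)

  fibre : {A : Set} → (Fin (n G * n H) → A) → V G → V H → A
  fibre f g h = f (combine g h)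

  unfibre : {A : Set} → (V G → V H → A) → Fin (n G * n H) → A
  unfibre ℓ v = uncurry ℓ (remQuot (n H) v)

  fibre-unfibre : {A : Set} (ℓ : V G → V H → A) → ∀ g h → fibre (unfibre ℓ) g h ≡ ℓ g h
  fibre-unfibre ℓ g h = cong (uncurry ℓ) (remQuot-combine g h)

  ∀-combine : (P : Fin (n G * n H) → Set) → (∀ g h → P (combine g h)) → ∀ v → P v
  ∀-combine P p v = subst P (combine-remQuot {n G} (n H) v) (p (proj₁ gh) (proj₂ gh))
    where gh = remQuot {n G} (n H) v

  r2weight-fibres : ∀ f → r2weight (n G * n H) f ≡ sumFin (n G) (λ g → r2weight (n H) (fibre f g))
  r2weight-fibres f = sumFin-combine (n G) (n H) (λ v → size (f v))

  SeesLex : (V G → V H → Bool × Bool) → Colour → V G → V H → Set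
  SeesLex ℓ c g h = Σ (V G) (λ g′ → Σ (V H) (λ h′ → LexAdj g h g′ h′ × c (ℓ g′ h′) ≡ true))

  sees⇒seesLex : ∀ f c g h → Sees (lexAdj G H) f c (combine g h) → SeesLex (fibre f) c g h
  sees⇒seesLex f c g h (u , adj , cfu≡true) =
    proj₁ gh′ , proj₂ gh′ ,
    subst id (lexAdj-combine g h _ _) (subst (lexAdj G H (combine g h)) (sym u≡) adj) ,
    subst (λ w → c (f w) ≡ true) (sym u≡) cfu≡true
    where
    gh′ = remQuot (n H) u
    u≡ = combine-remQuot {n G} (n H) u

  seesLex⇒sees : ∀ ℓ c g h → SeesLex ℓ c g h → Sees (lexAdj G H) (unfibre ℓ) c (combine g h)
  seesLex⇒sees ℓ c g h (g′ , h′ , adj , cℓ≡true) =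
    combine g′ h′ ,
    subst id (sym (lexAdj-combine g h g′ h′)) adj ,
    subst (λ x → c x ≡ true) (sym (fibre-unfibre ℓ g′ h′)) cℓ≡true

  shadow : (Fin (n G * n H) → Bool × Bool) → V G → Bool × Bool
  shadow f g = collapse (fibre f g)

  r2weight-shadow : ∀ f → r2weight (n G) (shadow f) ≤ r2weight (n G * n H) f
  r2weight-shadow f =
    ≤-trans (sumFin-mono (n G) (λ g → size-collapse (n H) (fibre f g)))
            (≤-reflexive (sym (r2weight-fibres f)))

  shadow-dominating : NonTrivial H → ∀ f c →
    (∀ v → f v ≡ ∅ → Sees (lexAdj G H) f c v) → IsDominating G (λ g → collapseᶜ c (fibre f g))
  shadow-dominating 2≤nH f c sees g with collapseᶜ c (fibre f g) in g∉D
  ... | true  = inj₁ refl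
  ... | false with r2weight<⇒empty (n H) (fibre f g)
                     (<-≤-trans (≰⇒> (collapseᶜ-false⇒light c (fibre f g) g∉D)) 2≤nH)
  ... | h , fgh≡∅ with sees⇒seesLex f c g h (sees (combine g h) fgh≡∅)
  ... | g′ , h′ , inj₁ g~g′ , cf≡true =
    inj₂ (g′ , collapseᶜ-intro c (fibre f g′) h′ cf≡true , Graph.sym G g~g′)
  ... | g′ , h′ , inj₂ (refl , _) , cf≡true
    with () ← trans (sym g∉D) (collapseᶜ-intro c (fibre f g) h′ cf≡true)

  2γ≤r2weight : NonTrivial H → ∀ {γ} → IsDomNum G γ →
    ∀ f → IsR2DF (n G * n H) (lexAdj G H) f → 2 * γ ≤ r2weight (n G * n H) f
  2γ≤r2weight 2≤nH {γ} (_ , γ-min) f isR2 = begin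
    2 * γ                                         ≡⟨ cong (γ +_) (+-identityʳ γ) ⟩
    γ + γ                                         ≤⟨ +-mono-≤ (γ-min (D proj₁) D₁-dominating)
                                                              (γ-min (D proj₂) D₂-dominating) ⟩
    card (D proj₁) + card (D proj₂)               ≡⟨ sym (sumFin-+ (n G) _ _) ⟩
    r2weight (n G) (shadow f)                     ≤⟨ r2weight-shadow f ⟩
    r2weight (n G * n H) f                        ∎
    where
    open ≤-Reasoning
    D : Colour → V G → Bool
    D c g = collapseᶜ c (fibre f g)
    D₁-dominating : IsDominating G (D proj₁)
    D₁-dominating = shadow-dominating 2≤nH f proj₁ (λ v fv≡∅ → proj₁ (isR2 v fv≡∅))
    D₂-dominating : IsDominating G (D proj₂)
    D₂-dominating = shadow-dominating 2≤nH f proj₂ (λ v fv≡∅ → proj₂ (isR2 v fv≡∅))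

  module Blowup {k} (fH : V H → Bool × Bool) (fH-r2 : IsR2DF (n H) (Adj H) fH)
                (fH-weight : r2weight (n H) fH ≤ k) where

    row : Bool → Bool → V H → Bool × Bool
    row true  _     = peak
    row false true  = fH
    row false false = λ _ → ∅

    r2weight-row : ∀ a b → r2weight (n H) (row a b) ≤ 2 * b2n a + k * b2n b
    r2weight-row true  b     = ≤-trans (r2weight-peak (n H)) (m≤m+n 2 (k * b2n b))
    r2weight-row false true  = ≤-trans fH-weight (≤-reflexive (sym (*-identityʳ k)))
    r2weight-row false false =
      ≤-trans (≤-reflexive (trans (sumFin-const (n H) 0) (*-zeroʳ (n H)))) z≤n

    row-uses : ∀ c → c (true , true) ≡ true → Uses c fH →
      ∀ a b → a ≡ true ⊎ b ≡ true → Uses c (row a b)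
    row-uses c c⊤ (h , _)  true  b     _ =
      proj₁ (peak-top h) , trans (cong c (proj₂ (peak-top h))) c⊤
    row-uses c c⊤ usesH    false true  _ = usesH
    row-uses c c⊤ usesH    false false (inj₁ ())
    row-uses c c⊤ usesH    false false (inj₂ ())

    module _ (A B : V G → Bool) where

      rows : V G → V H → Bool × Bool
      rows g = row (A g) (B g)

      r2weight-rows : r2weight (n G * n H) (unfibre rows) ≤ 2 * card A + k * card B
      r2weight-rows = begin
        r2weight (n G * n H) (unfibre rows)
          ≡⟨ r2weight-fibres (unfibre rows) ⟩
        sumFin (n G) (λ g → r2weight (n H) (fibre (unfibre rows) g))
          ≡⟨ sumFin-cong (n G) (λ g → sumFin-cong (n H) (λ h → cong size (fibre-unfibre rows g h))) ⟩
        sumFin (n G) (λ g → r2weight (n H) (rows g))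
          ≤⟨ sumFin-mono (n G) (λ g → r2weight-row (A g) (B g)) ⟩
        sumFin (n G) (λ g → 2 * b2n (A g) + k * b2n (B g))
          ≡⟨ sumFin-+ (n G) _ _ ⟩
        sumFin (n G) (λ g → 2 * b2n (A g)) + sumFin (n G) (λ g → k * b2n (B g))
          ≡⟨ cong₂ _+_ (sumFin-*ˡ (n G) 2 _) (sumFin-*ˡ (n G) k _) ⟩
        2 * card A + k * card B
          ∎
        where open ≤-Reasoning

      rows-sees : IsDomCouple G A B → ∀ c → c (true , true) ≡ true → Uses c fH →
        (∀ h → fH h ≡ ∅ → Sees (Adj H) fH c h) → ∀ g h → rows g h ≡ ∅ → SeesLex rows c g h
      rows-sees (disjoint , dominates) c c⊤ usesH seesH g h rgh≡∅ with A g in ea | B g in eb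
      ... | true  | true  = contradiction (ea , eb) (disjoint g)
      ... | false | true  =
        let (h′ , h~h′ , cfh′) = seesH h rgh≡∅
        in g , h′ , inj₂ (refl , h~h′) ,
           subst (λ x → c x ≡ true) (sym (cong₂ (λ a b → row a b h′) ea eb)) cfh′
      ... | _     | false =
        let (w , w∈A∪B , w~g) = dominates g eb
            (h′ , cr) = row-uses c c⊤ usesH (A w) (B w) w∈A∪B
        in w , h′ , inj₁ (Graph.sym G w~g) , cr

      rows-r2df : IsDomCouple G A B → Uses proj₁ fH → Uses proj₂ fH →
        IsR2DF (n G * n H) (lexAdj G H) (unfibre rows)
      rows-r2df couple uses₁ uses₂ =
        ∀-combine (λ v → unfibre rows v ≡ ∅ → Sees (lexAdj G H) (unfibre rows) proj₁ v
                                               × Sees (lexAdj G H) (unfibre rows) proj₂ v)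
          λ g h F≡∅ →
            let rgh≡∅ = trans (sym (fibre-unfibre rows g h)) F≡∅
            in seesLex⇒sees rows proj₁ g h
                 (rows-sees couple proj₁ refl uses₁ (λ h′ e → proj₁ (fH-r2 h′ e)) g h rgh≡∅) ,
               seesLex⇒sees rows proj₂ g h
                 (rows-sees couple proj₂ refl uses₂ (λ h′ e → proj₂ (fH-r2 h′ e)) g h rgh≡∅)

  r2NumLex≤couple-bound : NonTrivial H → ∀ {k r} → IsR2Num H k → IsR2NumLex G H r →
    ∀ A B → IsDomCouple G A B → r ≤ 2 * card A + k * card B
  r2NumLex≤couple-bound 2≤nH ((f , f-r2 , f-weight) , _) (_ , r-min) A B couple =
    let (fH , fH-r2 , fH-light , uses₁ , uses₂) = r2df-bichromatic (Adj H) f 2≤nH f-r2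
        open Blowup fH fH-r2 (≤-trans fH-light (≤-reflexive f-weight))
    in ≤-trans (r-min (unfibre (rows A B)) (rows-r2df A B couple uses₁ uses₂)) (r2weight-rows A B)

open Lexicographic

corollary12 : (G H : Graph) → NonTrivial G → NonTrivial H →
    Connected G → Connected H → IsR2Num H 3 →
    (γG r : ℕ) → IsDomNum G γG → IsR2NumLex G H r →
    (2 * γG ≤ r) ×
    ((A B : V G → Bool) → IsDomCouple G A B → r ≤ 2 * card A + 3 * card B)
corollary12 G H _ 2≤nH _ _ γr2H≡3 γG r γG-def r-def@((f , f-r2 , f-weight) , _) =
  subst (2 * γG ≤_) f-weight (2γ≤r2weight G H 2≤nH γG-def f f-r2) ,
  r2NumLex≤couple-bound G H 2≤nH γr2H≡3 r-def
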